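{- Let $n\ge 1$ and let $F_n$ be the fan graph with vertices $v_0,\dots,v_{2n}$ (edges $v_0v_i$ for $1\le i\le 2n$ and $v_{2j-1}v_{2j}$ for $1\le j\le n$). Let $(\mathbf d,\mathbf r)$ be an arithmetical structure on $F_n$, with $d_i$, $r_i$ the entries at $v_i$. If $\mathbf r\neq (1,1,\dots,1)$, then one of the following holds: (1) $d_0>2n$ and $d_i<2$ for some $i>0$; (2) $d_0<2n$ and $d_i>2$ for some $i>0$; (3) $d_0=2n$ and $d_i<2$, $d_j>2$ for some $0<i,j\le 2n$. Moreover, if $d_i=1$ for some $i$, then $d_u>1$ for every vertex $u$ adjacent to $v_i$.
   Context: For a finite connected graph $G$ with adjacency matrix $A$, an arithmetical structure on $G$ is a pair $(\mathbf d,\mathbf r)$ of vectors of positive integers indexed by the vertices such that $\mathbf r$ is primitive (gcd of entries equal to $1$) and $(\mathrm{diag}(\mathbf d)-A)\mathbf r=0$. -}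

module Defs where

open import Data.Nat using (ℕ; zero; suc; _+_; _*_; _≟_)
open import Data.Nat.GCD using (gcd)
open import Data.Bool using (Bool; true; false; _∨_; _∧_; if_then_else_)
open import Data.Fin using (Fin; toℕ)
open import Data.List using (List; foldr; map; filter)
open import Data.Nat.ListAction using (sum)
open import Data.List using () renaming (allFin to allFinL)
open import Data.Nat using (_%_)
open import Relation.Nullary.Decidable using (⌊_⌋)
open import Relation.Binary.PropositionalEquality using (_≡_)

Graph : ℕ → Set
Graph m = Fin m → Fin m → Bool

adjEntry : ∀ {m} → Graph m → Fin m → Fin m → ℕ
adjEntry G u v = if G u v then 1 else 0

Ar : ∀ {m} → Graph m → (Fin m → ℕ) → Fin m → ℕ
Ar {m} G r v = sum (map (λ u → adjEntry G v u * r u) (allFinL m))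

gcdAll : ∀ {m} → (Fin m → ℕ) → ℕ
gcdAll {m} r = foldr (λ u g → gcd (r u) g) 0 (allFinL m)

data Positive : ℕ → Set where
  pos : ∀ n → Positive (suc n)

record IsArithmetical {m} (G : Graph m) (d r : Fin m → ℕ) : Set where
  field
    d-pos     : ∀ v → Positive (d v)
    r-pos     : ∀ v → Positive (r v)
    r-primitive : gcdAll r ≡ 1
    kernel    : ∀ v → d v * r v ≡ Ar G r v

-- Fan graph F_n on vertices v_0,...,v_{2n}, vertex v_k is (k : Fin (suc (2 * n))).
-- For a, b ≥ 1: a,b form a rung pair iff a is odd and b = a + 1.
fanAdjℕ : ℕ → ℕ → Bool
fanAdjℕ zero zero = false
fanAdjℕ zero (suc b) = true
fanAdjℕ (suc a) zero = true
fanAdjℕ (suc a) (suc b) =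
  (⌊ (suc a) % 2 ≟ 1 ⌋ ∧ ⌊ suc b ≟ suc (suc a) ⌋) ∨
  (⌊ (suc b) % 2 ≟ 1 ⌋ ∧ ⌊ suc a ≟ suc (suc b) ⌋)

Fan : (n : ℕ) → Graph (suc (2 * n))
Fan n u v = fanAdjℕ (toℕ u) (toℕ v)

-- Summing d_v r_v = (A r)_v over all vertices and exchanging the double sum gives
-- Σ_v d_v r_v = Σ_v deg(v) r_v, which on F_n reads
-- d_0 r_0 + Σ_{i>0} d_i r_i = 2n r_0 + Σ_{i>0} 2 r_i.
-- Hence d_0 > 2n forces some d_i < 2, and d_0 < 2n some d_i > 2.  When d_0 = 2n, either some d_i
-- differs from 2, and then the balance needs one d_i below and one above 2, or every rung
-- v_a v_b has 2 r_a = r_0 + r_b and 2 r_b = r_0 + r_a, so r is constant and, being primitive, is 1.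
-- If d_i = 1 and u ~ v_i, then r_i = (A r)_i > r_u because v_i has a second neighbour, so
-- d_u r_u = (A r)_u ≥ r_i > r_u.

module Submission where

open import Defs
open import Data.Nat
  using (ℕ; zero; suc; _+_; _*_; _%_; _<_; _>_; _≤_; _≥_; _≡ᵇ_; z≤n; s≤s; z<s; s<s; >-nonZero)
open import Data.Nat.Properties
open import Data.Nat.Divisibility using (_∣_; _∣0; ∣-reflexive; ∣1⇒≡1)
open import Data.Nat.GCD using (gcd; gcd-greatest)
import Data.Nat.ListAction as List
open import Data.Nat.Tactic.RingSolver using (solve-∀)
open import Data.Fin using (Fin; zero; suc; toℕ; fromℕ<; punchIn; punchOut)
import Data.Fin.Properties as Finₚ
open import Data.Vec.Functional using (removeAt)
open import Data.List using ([]; _∷_; foldr; tabulate; allFin)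
open import Data.List.Properties using (map-tabulate)
open import Data.Bool using (true; _∧_; _∨_; if_then_else_)
open import Data.Bool.Properties using (∨-comm; ∧-zeroʳ; ∨-identityʳ; T-≡)
open import Data.Product using (∃; _×_; _,_; proj₁; proj₂)
open import Data.Sum using (_⊎_; inj₁; inj₂)
open import Function using (_∘_; id; Equivalence)
open import Relation.Nullary using (yes; no; contradiction)
open import Relation.Nullary.Decidable using (⌊_⌋; isYes≗does)
open import Relation.Binary.Definitions using (tri<; tri≈; tri>)
open import Relation.Binary.PropositionalEquality
open import Algebra.Properties.Semiring.Sum +-*-semiring
  using (sum; sum-syntax; sum-cong-≗; sum-remove; sum-replicate-zero; ∑-comm; *-distribʳ-sum)

Positive⇒0< : ∀ {n} → Positive n → 0 < n
Positive⇒0< (pos _) = z<s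

m+n≡o+p∧o<m⇒n<p : ∀ {m n o p} → m + n ≡ o + p → o < m → n < p
m+n≡o+p∧o<m⇒n<p {n = n} {o} {p} eq o<m =
  +-cancelˡ-< o n p (<-≤-trans (+-monoˡ-< n o<m) (≤-reflexive eq))

2a≡c+b∧2b≡c+a⇒a≡c : ∀ {a b c} → 2 * a ≡ c + b → 2 * b ≡ c + a → a ≡ c
2a≡c+b∧2b≡c+a⇒a≡c {a} {b} {c} 2a≡c+b 2b≡c+a =
  *-cancelˡ-≡ a c 3 (+-cancelʳ-≡ a (3 * a) (3 * c) (begin
  3 * a + a        ≡⟨ lhs a ⟩
  2 * (2 * a)      ≡⟨ cong (2 *_) 2a≡c+b ⟩
  2 * (c + b)      ≡⟨ *-distribˡ-+ 2 c b ⟩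
  2 * c + 2 * b    ≡⟨ cong (2 * c +_) 2b≡c+a ⟩
  2 * c + (c + a)  ≡⟨ rhs c a ⟩
  3 * c + a        ∎))
  where
  open ≡-Reasoning
  lhs : ∀ a → 3 * a + a ≡ 2 * (2 * a)
  lhs = solve-∀
  rhs : ∀ c a → 2 * c + (c + a) ≡ 3 * c + a
  rhs = solve-∀

listSum-tabulate : ∀ {k} (f : Fin k → ℕ) → List.sum (tabulate f) ≡ sum f
listSum-tabulate {zero} f = refl
listSum-tabulate {suc k} f = cong (f zero +_) (listSum-tabulate (f ∘ suc))

∑-ones : ∀ k → ∑[ i < k ] 1 ≡ k
∑-ones zero = refl
∑-ones (suc k) = cong suc (∑-ones k)

∑-δ : ∀ {k} (f : Fin k → ℕ) (j : Fin k) →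
      ∑[ i < k ] ((if toℕ i ≡ᵇ toℕ j then 1 else 0) * f i) ≡ f j
∑-δ {suc k} f zero =
  trans (cong₂ _+_ (*-identityˡ (f zero)) (sum-replicate-zero k)) (+-identityʳ (f zero))
∑-δ {suc k} f (suc j) = ∑-δ (f ∘ suc) j

∑-≥-term : ∀ {k} (f : Fin k → ℕ) i → f i ≤ sum f
∑-≥-term {suc k} f i = ≤-trans (m≤m+n (f i) _) (≤-reflexive (sym (sum-remove {i = i} f)))

∑-≥-pair : ∀ {k} (f : Fin k → ℕ) {i j} → i ≢ j → f i + f j ≤ sum f
∑-≥-pair {suc k} f {i} {j} i≢j = begin
  f i + f j                              ≡⟨ cong (λ j → f i + f j) (sym (Finₚ.punchIn-punchOut i≢j)) ⟩
  f i + removeAt f i (punchOut i≢j)      ≤⟨ +-monoʳ-≤ (f i) (∑-≥-term (removeAt f i) (punchOut i≢j)) ⟩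
  f i + sum (removeAt f i)               ≡⟨ sum-remove {i = i} f ⟨
  sum f                                  ∎
  where open ≤-Reasoning

∑-<⇒∃< : ∀ {k} (f g : Fin k → ℕ) → sum f < sum g → ∃ λ i → f i < g i
∑-<⇒∃< {suc k} f g ∑f<∑g with f zero <? g zero
... | yes f₀<g₀ = zero , f₀<g₀
... | no f₀≮g₀ =
  let (i , fᵢ<gᵢ) = ∑-<⇒∃< (f ∘ suc) (g ∘ suc)
                      (+-cancelˡ-< (g zero) _ _ (≤-<-trans (+-monoˡ-≤ _ (≮⇒≥ f₀≮g₀)) ∑f<∑g))
  in suc i , fᵢ<gᵢ

∑-≤⇒∃> : ∀ {k} (f g : Fin k → ℕ) i → sum g ≤ sum f → f i < g i → ∃ λ j → g j < f j
∑-≤⇒∃> {suc k} f g i ∑g≤∑f fᵢ<gᵢ =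
  let (j , gⱼ<fⱼ) = ∑-<⇒∃< (removeAt g i) (removeAt f i) (+-cancelˡ-< (f i) _ _ (begin-strict
        f i + sum (removeAt g i)  <⟨ +-monoˡ-< _ fᵢ<gᵢ ⟩
        g i + sum (removeAt g i)  ≡⟨ sum-remove {i = i} g ⟨
        sum g                     ≤⟨ ∑g≤∑f ⟩
        sum f                     ≡⟨ sum-remove {i = i} f ⟩
        f i + sum (removeAt f i)  ∎))
  in punchIn i j , gⱼ<fⱼ
  where open ≤-Reasoning

∣gcdAll : ∀ {m c} (r : Fin m → ℕ) → (∀ v → c ∣ r v) → c ∣ gcdAll r
∣gcdAll {m} {c} r c∣r = ∣foldr (allFin m)
  where
  ∣foldr : ∀ us → c ∣ foldr (λ u g → gcd (r u) g) 0 us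
  ∣foldr []       = c ∣0
  ∣foldr (u ∷ us) = gcd-greatest (c∣r u) (∣foldr us)

primitive-constant≡1 : ∀ {m c} {r : Fin m → ℕ} → gcdAll r ≡ 1 → (∀ v → r v ≡ c) → c ≡ 1
primitive-constant≡1 {r = r} gcd≡1 r≡c =
  ∣1⇒≡1 (subst (_ ∣_) gcd≡1 (∣gcdAll r (∣-reflexive ∘ sym ∘ r≡c)))

Undirected : ∀ {m} → Graph m → Set
Undirected G = ∀ u v → G u v ≡ G v u

degree : ∀ {m} → Graph m → Fin m → ℕ
degree {m} G v = ∑[ u < m ] adjEntry G v u

module _ {m} (G : Graph m) where

  Ar≡∑ : ∀ r v → Ar G r v ≡ ∑[ u < m ] (adjEntry G v u * r u)
  Ar≡∑ r v = trans (cong List.sum (map-tabulate id term)) (listSum-tabulate term)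
    where
    term : Fin m → ℕ
    term u = adjEntry G v u * r u

  Ar-ones≡degree : ∀ v → Ar G (λ _ → 1) v ≡ degree G v
  Ar-ones≡degree v = trans (Ar≡∑ _ v) (sum-cong-≗ (λ u → *-identityʳ (adjEntry G v u)))

  adjacent⇒adjEntry*≡ : ∀ {v u} x → G v u ≡ true → adjEntry G v u * x ≡ x
  adjacent⇒adjEntry*≡ x vu = trans (cong (λ b → (if b then 1 else 0) * x) vu) (*-identityˡ x)

  adjacent⇒≤Ar : ∀ r {v u} → G v u ≡ true → r u ≤ Ar G r v
  adjacent⇒≤Ar r {v} {u} vu = begin
    r u                                ≡⟨ adjacent⇒adjEntry*≡ (r u) vu ⟨
    adjEntry G v u * r u               ≤⟨ ∑-≥-term (λ u → adjEntry G v u * r u) u ⟩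
    ∑[ u < m ] (adjEntry G v u * r u)  ≡⟨ Ar≡∑ r v ⟨
    Ar G r v                           ∎
    where open ≤-Reasoning

  adjacent-pair⇒≤Ar : ∀ r {v u w} → G v u ≡ true → G v w ≡ true → u ≢ w → r u + r w ≤ Ar G r v
  adjacent-pair⇒≤Ar r {v} {u} {w} vu vw u≢w = begin
    r u + r w
      ≡⟨ cong₂ _+_ (adjacent⇒adjEntry*≡ (r u) vu) (adjacent⇒adjEntry*≡ (r w) vw) ⟨
    adjEntry G v u * r u + adjEntry G v w * r w
      ≤⟨ ∑-≥-pair (λ u → adjEntry G v u * r u) u≢w ⟩
    ∑[ u < m ] (adjEntry G v u * r u)
      ≡⟨ Ar≡∑ r v ⟨
    Ar G r v
      ∎
    where open ≤-Reasoning

  ∑-Ar≡∑-degree : Undirected G → ∀ r → ∑[ v < m ] Ar G r v ≡ ∑[ u < m ] (degree G u * r u)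
  ∑-Ar≡∑-degree undirected r = begin
    ∑[ v < m ] Ar G r v
      ≡⟨ sum-cong-≗ (Ar≡∑ r) ⟩
    ∑[ v < m ] ∑[ u < m ] (adjEntry G v u * r u)
      ≡⟨ ∑-comm (λ v u → adjEntry G v u * r u) ⟩
    ∑[ u < m ] ∑[ v < m ] (adjEntry G v u * r u)
      ≡⟨ sum-cong-≗ (λ u → sum-cong-≗ (λ v → cong (λ b → (if b then 1 else 0) * r u) (undirected v u))) ⟩
    ∑[ u < m ] ∑[ v < m ] (adjEntry G u v * r u)
      ≡⟨ sum-cong-≗ (λ u → *-distribʳ-sum (r u) (adjEntry G u)) ⟨
    ∑[ u < m ] (degree G u * r u)
      ∎
    where open ≡-Reasoning

module _ {m} {G : Graph m} {d r} (A : IsArithmetical G d r) where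
  open IsArithmetical A

  ∑-d*r≡∑-degree*r : Undirected G → ∑[ v < m ] (d v * r v) ≡ ∑[ v < m ] (degree G v * r v)
  ∑-d*r≡∑-degree*r undirected = trans (sum-cong-≗ kernel) (∑-Ar≡∑-degree G undirected r)

  d≡1⇒neighbour-d>1 : ∀ {i u w} → d i ≡ 1 → G i u ≡ true → G u i ≡ true → G i w ≡ true → u ≢ w →
                      1 < d u
  d≡1⇒neighbour-d>1 {i} {u} {w} dᵢ≡1 iu ui iw u≢w =
    *-cancelʳ-< (r u) 1 (d u) (begin-strict
    1 * r u     ≡⟨ *-identityˡ (r u) ⟩
    r u         <⟨ m<m+n (r u) (Positive⇒0< (r-pos w)) ⟩
    r u + r w   ≤⟨ adjacent-pair⇒≤Ar G r iu iw u≢w ⟩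
    Ar G r i    ≡⟨ kernel i ⟨
    d i * r i   ≡⟨ cong (_* r i) dᵢ≡1 ⟩
    1 * r i     ≡⟨ *-identityˡ (r i) ⟩
    r i         ≤⟨ adjacent⇒≤Ar G r ui ⟩
    Ar G r u    ≡⟨ kernel u ⟨
    d u * r u   ∎)
    where open ≤-Reasoning

-- Index a of Fin (2 * n) stands for the vertex v_(a+1); the rungs v_(2j+1) v_(2j+2) pair 2j with 2j+1.
partnerℕ : ℕ → ℕ
partnerℕ 0 = 1
partnerℕ 1 = 0
partnerℕ (suc (suc a)) = suc (suc (partnerℕ a))

partnerℕ-involutive : ∀ a → partnerℕ (partnerℕ a) ≡ a
partnerℕ-involutive 0 = refl
partnerℕ-involutive 1 = refl
partnerℕ-involutive (suc (suc a)) = cong (2 +_) (partnerℕ-involutive a)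

partnerℕ-≢ : ∀ a → partnerℕ a ≢ a
partnerℕ-≢ 0 ()
partnerℕ-≢ 1 ()
partnerℕ-≢ (suc (suc a)) eq = partnerℕ-≢ a (suc-injective (suc-injective eq))

partnerℕ-< : ∀ n {a} → a < 2 * n → partnerℕ a < 2 * n
partnerℕ-< (suc n) {a} a<2n =
  subst (partnerℕ a <_) (sym (*-suc 2 n)) (step a (subst (a <_) (*-suc 2 n) a<2n))
  where
  step : ∀ a → a < 2 + 2 * n → partnerℕ a < 2 + 2 * n
  step 0 _ = s<s z<s
  step 1 _ = z<s
  step (suc (suc a)) (s<s (s<s a<2n)) = s<s (s<s (partnerℕ-< n a<2n))

fanAdjℕ-comm : ∀ a b → fanAdjℕ a b ≡ fanAdjℕ b a
fanAdjℕ-comm zero    zero    = refl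
fanAdjℕ-comm zero    (suc b) = refl
fanAdjℕ-comm (suc a) zero    = refl
fanAdjℕ-comm (suc a) (suc b) = ∨-comm (⌊ suc a % 2 ≟ 1 ⌋ ∧ ⌊ suc b ≟ suc (suc a) ⌋) _

-- ⌊_⌋ does not compute on open terms, so the tests are first turned into _≡ᵇ_, which does.
fanAdjℕ-suc : ∀ a b → fanAdjℕ (suc a) (suc b) ≡ (b ≡ᵇ partnerℕ a)
fanAdjℕ-suc a b = trans
  (cong₂ _∨_ (cong₂ _∧_ (isYes≗does (suc a % 2 ≟ 1)) (isYes≗does (suc b ≟ suc (suc a))))
             (cong₂ _∧_ (isYes≗does (suc b % 2 ≟ 1)) (isYes≗does (suc a ≟ suc (suc b)))))
  (rung a b)
  where
  rung : ∀ a b → ((suc a % 2 ≡ᵇ 1) ∧ (b ≡ᵇ suc a)) ∨ ((suc b % 2 ≡ᵇ 1) ∧ (a ≡ᵇ suc b))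
                 ≡ (b ≡ᵇ partnerℕ a)
  rung 0 0 = refl
  rung 0 1 = refl
  rung 0 (suc (suc b)) = ∧-zeroʳ _
  rung 1 0 = refl
  rung 1 1 = refl
  rung 1 (suc (suc b)) = ∧-zeroʳ _
  rung (suc (suc a)) 0 = trans (∨-identityʳ _) (∧-zeroʳ _)
  rung (suc (suc a)) 1 = trans (∨-identityʳ _) (∧-zeroʳ _)
  rung (suc (suc a)) (suc (suc b)) = rung a b

module FanGraph (n : ℕ) where

  partner : Fin (2 * n) → Fin (2 * n)
  partner i = fromℕ< (partnerℕ-< n (Finₚ.toℕ<n i))

  toℕ-partner : (i : Fin (2 * n)) → toℕ (partner i) ≡ partnerℕ (toℕ i)
  toℕ-partner i = Finₚ.toℕ-fromℕ< _

  partner-involutive : (i : Fin (2 * n)) → partner (partner i) ≡ i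
  partner-involutive i = Finₚ.toℕ-injective (begin
    toℕ (partner (partner i))   ≡⟨ toℕ-partner (partner i) ⟩
    partnerℕ (toℕ (partner i))  ≡⟨ cong partnerℕ (toℕ-partner i) ⟩
    partnerℕ (partnerℕ (toℕ i)) ≡⟨ partnerℕ-involutive (toℕ i) ⟩
    toℕ i                       ∎)
    where open ≡-Reasoning

  partner-≢ : (i : Fin (2 * n)) → partner i ≢ i
  partner-≢ i eq = partnerℕ-≢ (toℕ i) (trans (sym (toℕ-partner i)) (cong toℕ eq))

  Fan-undirected : Undirected (Fan n)
  Fan-undirected u v = fanAdjℕ-comm (toℕ u) (toℕ v)

  Fan-suc-suc : ∀ i u → Fan n (suc i) (suc u) ≡ (toℕ u ≡ᵇ toℕ (partner i))
  Fan-suc-suc i u = trans (fanAdjℕ-suc (toℕ i) (toℕ u)) (cong (toℕ u ≡ᵇ_) (sym (toℕ-partner i)))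

  Fan-rung : ∀ i → Fan n (suc i) (suc (partner i)) ≡ true
  Fan-rung i = trans (Fan-suc-suc i (partner i)) (Equivalence.to T-≡ (≡⇒≡ᵇ (toℕ (partner i)) _ refl))

  Ar-Fan-suc : ∀ r i → Ar (Fan n) r (suc i) ≡ r zero + r (suc (partner i))
  Ar-Fan-suc r i = trans (Ar≡∑ (Fan n) r (suc i)) (cong₂ _+_ (*-identityˡ (r zero)) (begin
    ∑[ u < 2 * n ] (adjEntry (Fan n) (suc i) (suc u) * r (suc u))
      ≡⟨ sum-cong-≗ (λ u → cong (λ b → (if b then 1 else 0) * r (suc u)) (Fan-suc-suc i u)) ⟩
    ∑[ u < 2 * n ] ((if toℕ u ≡ᵇ toℕ (partner i) then 1 else 0) * r (suc u))
      ≡⟨ ∑-δ (r ∘ suc) (partner i) ⟩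
    r (suc (partner i)) ∎))
    where open ≡-Reasoning

  degree-Fan-zero : degree (Fan n) zero ≡ 2 * n
  degree-Fan-zero = ∑-ones (2 * n)

  degree-Fan-suc : ∀ i → degree (Fan n) (suc i) ≡ 2
  degree-Fan-suc i = trans (sym (Ar-ones≡degree (Fan n) (suc i))) (Ar-Fan-suc (λ _ → 1) i)

  Fan-second-neighbour : ∀ i u → Fan n i u ≡ true → ∃ λ w → Fan n i w ≡ true × u ≢ w
  Fan-second-neighbour zero    (suc u) _ =
    suc (partner u) , refl , λ eq → partner-≢ u (sym (Finₚ.suc-injective eq))
  Fan-second-neighbour (suc i) zero    _ = suc (partner i) , Fan-rung i , λ ()
  Fan-second-neighbour (suc i) (suc u) _ = zero , refl , λ ()

∃-nonzero : ∀ {k} {P : Fin (suc k) → Set} → (∃ λ i → P (suc i)) → ∃ λ v → toℕ v ≥ 1 × P v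
∃-nonzero (i , pᵢ) = suc i , s≤s z≤n , pᵢ

module ArithmeticalOnFan {n d r} (A : IsArithmetical (Fan n) d r) where
  open IsArithmetical A
  open FanGraph n

  ∑dr ∑2r : ℕ
  ∑dr = ∑[ i < 2 * n ] (d (suc i) * r (suc i))
  ∑2r = ∑[ i < 2 * n ] (2 * r (suc i))

  balance : d zero * r zero + ∑dr ≡ 2 * n * r zero + ∑2r
  balance = trans (∑-d*r≡∑-degree*r A Fan-undirected) (cong₂ _+_
    (cong (_* r zero) degree-Fan-zero)
    (sum-cong-≗ (λ i → cong (_* r (suc i)) (degree-Fan-suc i))))

  kernel-suc : ∀ i → d (suc i) * r (suc i) ≡ r zero + r (suc (partner i))
  kernel-suc i = trans (kernel (suc i)) (Ar-Fan-suc r i)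

  *r-cancel-< : ∀ {a b} v → a * r v < b * r v → a < b
  *r-cancel-< {a} {b} v = *-cancelʳ-< (r v) a b

  *r-mono-< : ∀ {a b} v → a < b → a * r v < b * r v
  *r-mono-< v = *-monoˡ-< (r v) {{>-nonZero (Positive⇒0< (r-pos v))}}

  ∑dr<∑2r⇒low : ∑dr < ∑2r → ∃ λ i → d (suc i) < 2
  ∑dr<∑2r⇒low lt = let (i , lt′) = ∑-<⇒∃< _ _ lt in i , *r-cancel-< (suc i) lt′

  ∑2r<∑dr⇒high : ∑2r < ∑dr → ∃ λ i → 2 < d (suc i)
  ∑2r<∑dr⇒high lt = let (i , lt′) = ∑-<⇒∃< _ _ lt in i , *r-cancel-< (suc i) lt′

  d₀>2n⇒low : 2 * n < d zero → ∃ λ i → d (suc i) < 2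
  d₀>2n⇒low lt = ∑dr<∑2r⇒low (m+n≡o+p∧o<m⇒n<p balance (*r-mono-< zero lt))

  d₀<2n⇒high : d zero < 2 * n → ∃ λ i → 2 < d (suc i)
  d₀<2n⇒high lt = ∑2r<∑dr⇒high (m+n≡o+p∧o<m⇒n<p (sym balance) (*r-mono-< zero lt))

  d₀≡2n⇒balanced : d zero ≡ 2 * n → ∑dr ≡ ∑2r
  d₀≡2n⇒balanced eq =
    +-cancelˡ-≡ (2 * n * r zero) ∑dr ∑2r (trans (cong (λ x → x * r zero + ∑dr) (sym eq)) balance)

  rungs-2⇒constant : (∀ i → d (suc i) ≡ 2) → ∀ v → r v ≡ r zero
  rungs-2⇒constant d≡2 zero    = refl
  rungs-2⇒constant d≡2 (suc i) = 2a≡c+b∧2b≡c+a⇒a≡c (rung i)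
    (subst (λ j → 2 * r (suc (partner i)) ≡ r zero + r (suc j)) (partner-involutive i) (rung (partner i)))
    where
    rung : ∀ i → 2 * r (suc i) ≡ r zero + r (suc (partner i))
    rung i = trans (cong (_* r (suc i)) (sym (d≡2 i))) (kernel-suc i)

  balanced⇒low×high : ∑dr ≡ ∑2r → ∀ i → d (suc i) ≢ 2 →
                      (∃ λ i → d (suc i) < 2) × (∃ λ j → 2 < d (suc j))
  balanced⇒low×high eq i dᵢ≢2 with <-cmp (d (suc i)) 2
  ... | tri< dᵢ<2 _ _ =
    let (j , lt) = ∑-≤⇒∃> _ _ i (≤-reflexive (sym eq)) (*r-mono-< (suc i) dᵢ<2)
    in (i , dᵢ<2) , (j , *r-cancel-< (suc j) lt)
  ... | tri≈ _ dᵢ≡2 _ = contradiction dᵢ≡2 dᵢ≢2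
  ... | tri> _ _ dᵢ>2 =
    let (j , lt) = ∑-≤⇒∃> _ _ i (≤-reflexive eq) (*r-mono-< (suc i) dᵢ>2)
    in (j , *r-cancel-< (suc j) lt) , (i , dᵢ>2)

  d₀≡2n⇒low×high : d zero ≡ 2 * n → (∃ λ v → r v ≢ 1) →
                   (∃ λ i → d (suc i) < 2) × (∃ λ j → 2 < d (suc j))
  d₀≡2n⇒low×high eq (v , rᵥ≢1) with Finₚ.all? (λ i → d (suc i) ≟ 2)
  ... | yes d≡2 =
    contradiction (trans (constant v) (primitive-constant≡1 r-primitive constant)) rᵥ≢1
    where
    constant : ∀ v → r v ≡ r zero
    constant = rungs-2⇒constant d≡2
  ... | no d≢2 =
    let (i , dᵢ≢2) = Finₚ.¬∀⟶∃¬ (2 * n) _ (λ i → d (suc i) ≟ 2) d≢2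
    in balanced⇒low×high (d₀≡2n⇒balanced eq) i dᵢ≢2

  d≡1⇒Fan-neighbour-d>1 : ∀ i → d i ≡ 1 → ∀ u → Fan n i u ≡ true → d u > 1
  d≡1⇒Fan-neighbour-d>1 i dᵢ≡1 u iu =
    let (w , iw , u≢w) = Fan-second-neighbour i u iu
    in d≡1⇒neighbour-d>1 A dᵢ≡1 iu (trans (Fan-undirected u i) iu) iw u≢w

mainTheorem2 : (n : ℕ) → n ≥ 1 → (d r : Fin (suc (2 * n)) → ℕ) →
    IsArithmetical (Fan n) d r →
    ((∃ λ v → r v ≢ 1) →
      ((d zero > 2 * n × ∃ λ i → toℕ i ≥ 1 × d i < 2)
      ⊎ (d zero < 2 * n × ∃ λ i → toℕ i ≥ 1 × d i > 2)
      ⊎ (d zero ≡ 2 * n × (∃ λ i → toℕ i ≥ 1 × d i < 2) × (∃ λ j → toℕ j ≥ 1 × d j > 2))))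
    × (∀ i → d i ≡ 1 → ∀ u → Fan n i u ≡ true → d u > 1)
mainTheorem2 n _ d r A .proj₁ r≢1 with <-cmp (d zero) (2 * n)
... | tri> _ _ d₀>2n = inj₁ (d₀>2n , ∃-nonzero (ArithmeticalOnFan.d₀>2n⇒low {n} A d₀>2n))
... | tri< d₀<2n _ _ = inj₂ (inj₁ (d₀<2n , ∃-nonzero (ArithmeticalOnFan.d₀<2n⇒high {n} A d₀<2n)))
... | tri≈ _ d₀≡2n _ =
  let (low , high) = ArithmeticalOnFan.d₀≡2n⇒low×high {n} A d₀≡2n r≢1
  in inj₂ (inj₂ (d₀≡2n , ∃-nonzero low , ∃-nonzero high))
mainTheorem2 n _ d r A .proj₂ = ArithmeticalOnFan.d≡1⇒Fan-neighbour-d>1 {n} A
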